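{- Let $\lambda=\sum_{i=1}^n m_i\omega_i\in\mathcal P^+$. Then the number of equivalence classes of $\mathcal P^+(\lambda,2)$ under $\sim$ is $$|\mathcal P^+(\lambda,2)/\!\sim|=\begin{cases}\tfrac12\left(\prod_{i=1}^n(m_i+1)+1\right)&\text{if all }m_i\text{ are even},\\ \tfrac12\prod_{i=1}^n(m_i+1)&\text{otherwise.}\end{cases}$$
   Context: $\mathcal P^+=\mathbb Z_{\ge0}^n$ with standard basis $\omega_1,\dots,\omega_n$ and coordinate functionals $\omega_i^*$. $\mathcal P^+(\lambda,2)$ is the set of pairs $(\lambda_1,\lambda_2)$ of elements of $\mathcal P^+$ with $\lambda_1+\lambda_2=\lambda$. For $1\le i\le j\le n$, $\ell\in\{1,2\}$, $r_{(i,j),\ell}(\boldsymbol\lambda)=\min\{\sum_{t=i}^j\omega_t^*(\lambda_{n_1}+\dots+\lambda_{n_\ell}):1\le n_1<\dots<n_\ell\le 2\}$, and $\boldsymbol\lambda\sim\boldsymbol\mu$ iff $r_{(i,j),\ell}(\boldsymbol\lambda)=r_{(i,j),\ell}(\boldsymbol\mu)$ for all $i\le j$, $\ell$. -}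

module Defs where

open import Data.Nat using (ℕ; zero; suc; _+_; _*_; _≤_; _⊓_; _≤ᵇ_)
open import Data.Nat.Divisibility using (_∣_)
open import Data.Bool using (if_then_else_; _∧_)
open import Data.Fin using (Fin; toℕ)
open import Data.Vec using (tabulate; sum; foldr′)
open import Data.Product using (Σ; _×_; proj₁; proj₂)
open import Relation.Binary.PropositionalEquality using (_≡_)

-- Dominant weights P⁺ = ℤ_{≥0}^n, as functions Fin n → ℕ
-- (coordinate t is ω*_{t+1}, indices shifted to start at 0).
Weight : ℕ → Set
Weight n = Fin n → ℕ

_⊕_ : ∀ {n} → Weight n → Weight n → Weight n
(a ⊕ b) t = a t + b t

intervalSum : ∀ {n} → Fin n → Fin n → Weight n → ℕ
intervalSum {n} i j μ =
  sum (tabulate (λ t → if (toℕ i ≤ᵇ toℕ t) ∧ (toℕ t ≤ᵇ toℕ j) then μ t else 0))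

P2 : ∀ {n} → Weight n → Set
P2 {n} lam = Σ (Weight n × Weight n) (λ p → ∀ t → proj₁ p t + proj₂ p t ≡ lam t)

-- r_{(i,j),ℓ} for ℓ = 1 and ℓ = 2 (with k = 2 parts, the minimum over
-- 1 ≤ n₁ < … < n_ℓ ≤ 2).
r1 : ∀ {n} {lam : Weight n} → Fin n → Fin n → P2 lam → ℕ
r1 i j p = intervalSum i j (proj₁ (proj₁ p)) ⊓ intervalSum i j (proj₂ (proj₁ p))

r2 : ∀ {n} {lam : Weight n} → Fin n → Fin n → P2 lam → ℕ
r2 i j p = intervalSum i j (proj₁ (proj₁ p) ⊕ proj₂ (proj₁ p))

_∼_ : ∀ {n} {lam : Weight n} → P2 lam → P2 lam → Set
_∼_ {n} p q = ∀ (i j : Fin n) → toℕ i ≤ toℕ j → (r1 i j p ≡ r1 i j q) × (r2 i j p ≡ r2 i j q)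

NumClasses : ∀ {n} (lam : Weight n) → ℕ → Set
NumClasses lam k =
  Σ (Fin k → P2 lam) (λ f →
     (∀ (x : P2 lam) → Σ (Fin k) (λ a → x ∼ f a)) ×
     (∀ (a b : Fin k) → f a ∼ f b → a ≡ b))

prodSucc : ∀ {n} → Weight n → ℕ
prodSucc m = foldr′ _*_ 1 (tabulate (λ t → suc (m t)))

AllEven : ∀ {n} → Weight n → Set
AllEven m = ∀ t → 2 ∣ m t

-- The r_{(i,j),2} are constant on P⁺(λ,2), and the minima r_{(i,j),1} over
-- all intervals determine the unordered pair {λ₁, λ₂}: by induction on n,
-- if the first coordinates get swapped while the tails do not, the prefix
-- sums through the first coordinate force the two tails to coincide unless
-- the first coordinates are already equal.  So ∼ identifies exactly a pair
-- with its swap, and the classes are the orbits of the swap on the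
-- N = ∏ (mᵢ + 1) pairs; its only possible fixed point is (λ/2, λ/2), which
-- exists iff all mᵢ are even, i.e. iff N is odd.  Coding λ₁ in mixed radix
-- (mᵢ + 1) turns the swap into c ↦ N - 1 - c, so the codes below ⌈N/2⌉ give
-- one representative per class.

module Submission where

open import Defs
open import Data.Nat
  using (ℕ; zero; suc; _+_; _*_; _∸_; _≤_; _<_; _⊓_; _≤ᵇ_; z≤n; s≤s; s≤s⁻¹; _%_; _/_; _≟_; _<?_)
open import Data.Nat.Properties
open import Data.Nat.DivMod
open import Data.Nat.Divisibility using (_∣_; divides; ∣-refl; ∣m∣n⇒∣m+n; ∣m⇒∣m*n; ∣n⇒∣m*n)
open import Data.Nat.Tactic.RingSolver using (solve-∀)
open import Data.Bool using (if_then_else_; _∧_)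
open import Data.Fin using (Fin; toℕ; fromℕ<) renaming (zero to fzero; suc to fsuc)
open import Data.Fin.Properties using (toℕ-injective; toℕ-fromℕ<; toℕ<n)
open import Data.Vec using (tabulate; sum)
open import Data.Vec.Properties using (tabulate-cong)
open import Data.Vec.Functional using (head; tail)
open import Data.Product using (Σ; ∃; _×_; _,_; proj₁; proj₂)
open import Data.Sum using (_⊎_; inj₁; inj₂; [_,_]; map; swap)
open import Function using (_∘_)
open import Relation.Nullary using (¬_; yes; no; contradiction)
open import Relation.Binary.PropositionalEquality
  using (_≡_; _≢_; _≗_; refl; sym; trans; cong; cong₂; subst; module ≡-Reasoning)

≗-from-head-tail : ∀ {n} {μ ν : Weight (suc n)} → head μ ≡ head ν → tail μ ≗ tail ν → μ ≗ ν
≗-from-head-tail h≡ t≗ fzero    = h≡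
≗-from-head-tail h≡ t≗ (fsuc t) = t≗ t

partner-same : ∀ {a b c d} → a + b ≡ c + d → c ≡ a → d ≡ b
partner-same sums refl = sym (+-cancelˡ-≡ _ _ _ sums)

partner-swap : ∀ {a b c d} → a + b ≡ c + d → c ≡ b → d ≡ a
partner-swap {a} {b} {d = d} sums refl = sym (+-cancelˡ-≡ b a d (trans (+-comm b a) sums))

⊓-+-member : ∀ {p q r s} → p ⊓ q ≡ r ⊓ s → p + q ≡ r + s → r ≡ p ⊎ r ≡ q
⊓-+-member {p} {q} {r} {s} ⊓≡ +≡ with ≤-total r s
... | inj₁ r≤s = map r≡ r≡ (⊓-sel p q)
  where
  r≡ : ∀ {x} → p ⊓ q ≡ x → r ≡ x
  r≡ = trans (sym (m≤n⇒m⊓n≡m r≤s)) ∘ trans (sym ⊓≡)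
... | inj₂ s≤r = swap (map (partner-same p+q≡s+r ∘ s≡) (partner-swap p+q≡s+r ∘ s≡) (⊓-sel p q))
  where
  s≡ : ∀ {x} → p ⊓ q ≡ x → s ≡ x
  s≡ = trans (sym (m≥n⇒m⊓n≡n s≤r)) ∘ trans (sym ⊓≡)
  p+q≡s+r : p + q ≡ s + r
  p+q≡s+r = trans +≡ (+-comm r s)

⊓-cross-cancel : ∀ {x y A B} → x ≢ y → (x + A) ⊓ (y + B) ≡ (y + A) ⊓ (x + B) → A ≡ B
⊓-cross-cancel {x} {y} {A} {B} x≢y ⊓≡ =
  [ (λ yA≡xA → contradiction (+-cancelʳ-≡ A x y (sym yA≡xA)) x≢y) , +-cancelˡ-≡ y A B ]
  (⊓-+-member ⊓≡ (cross-sums x y A B))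
  where
  cross-sums : ∀ x y A B → (x + A) + (y + B) ≡ (y + A) + (x + B)
  cross-sums = solve-∀

≤ᵇ-suc : ∀ a b → (suc a ≤ᵇ suc b) ≡ (a ≤ᵇ b)
≤ᵇ-suc zero    b = refl
≤ᵇ-suc (suc a) b = refl

intervalSum-cong : ∀ {n} (i j : Fin n) {μ ν : Weight n} → μ ≗ ν → intervalSum i j μ ≡ intervalSum i j ν
intervalSum-cong i j μ≗ν =
  cong sum (tabulate-cong (λ t →
    cong (λ x → if (toℕ i ≤ᵇ toℕ t) ∧ (toℕ t ≤ᵇ toℕ j) then x else 0) (μ≗ν t)))

intervalSum-suc : ∀ {n} (i j : Fin n) (μ : Weight (suc n)) →
                  intervalSum (fsuc i) (fsuc j) μ ≡ intervalSum i j (tail μ)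
intervalSum-suc i j μ = cong sum (tabulate-cong (λ t →
  cong₂ (λ x y → if x ∧ y then μ (fsuc t) else 0) (≤ᵇ-suc (toℕ i) (toℕ t)) (≤ᵇ-suc (toℕ t) (toℕ j))))

prefixSum : ∀ {n} → Weight n → Fin n → ℕ
prefixSum μ fzero    = head μ
prefixSum μ (fsuc j) = head μ + prefixSum (tail μ) j

sum-zeros : ∀ n → sum (tabulate {n = n} (λ _ → 0)) ≡ 0
sum-zeros zero    = refl
sum-zeros (suc n) = sum-zeros n

intervalSum-zero : ∀ {n} (j : Fin (suc n)) (μ : Weight (suc n)) → intervalSum fzero j μ ≡ prefixSum μ j
intervalSum-zero {n} fzero    μ = trans (cong (head μ +_) (sum-zeros n)) (+-identityʳ (head μ))
intervalSum-zero {suc n} (fsuc j) μ = cong (head μ +_) (begin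
  sum (tabulate (λ t → if toℕ (fsuc t) ≤ᵇ toℕ (fsuc j) then μ (fsuc t) else 0))
    ≡⟨ cong sum (tabulate-cong (λ t →
         cong (λ x → if x then μ (fsuc t) else 0) (≤ᵇ-suc (toℕ t) (toℕ j)))) ⟩
  intervalSum fzero j (tail μ)
    ≡⟨ intervalSum-zero j (tail μ) ⟩
  prefixSum (tail μ) j ∎)
  where open ≡-Reasoning

prefixSum-cong : ∀ {n} {μ ν : Weight n} → μ ≗ ν → ∀ j → prefixSum μ j ≡ prefixSum ν j
prefixSum-cong μ≗ν fzero    = μ≗ν fzero
prefixSum-cong μ≗ν (fsuc j) = cong₂ _+_ (μ≗ν fzero) (prefixSum-cong (μ≗ν ∘ fsuc) j)

prefixSum-injective : ∀ {n} {μ ν : Weight n} → (∀ j → prefixSum μ j ≡ prefixSum ν j) → μ ≗ ν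
prefixSum-injective {zero}            prefix≡ ()
prefixSum-injective {suc n} {μ} {ν} prefix≡ = ≗-from-head-tail (prefix≡ fzero) (prefixSum-injective tail≡)
  where
  tail≡ : ∀ j → prefixSum (tail μ) j ≡ prefixSum (tail ν) j
  tail≡ j = +-cancelˡ-≡ (head μ) _ _
    (trans (prefix≡ (fsuc j)) (cong (_+ prefixSum (tail ν) j) (sym (prefix≡ fzero))))

complement-side : ∀ {n} {a b c d : Weight n} → a ⊕ b ≗ c ⊕ d → c ≗ a ⊎ c ≗ b → d ≗ b ⊎ d ≗ a
complement-side sums (inj₁ c≗a) = inj₁ (λ t → partner-same (sums t) (c≗a t))
complement-side sums (inj₂ c≗b) = inj₂ (λ t → partner-swap (sums t) (c≗b t))

first-swapped-rest-same : ∀ {n} {a b c d : Weight (suc n)} → a ⊕ b ≗ c ⊕ d →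
  (∀ j → prefixSum a j ⊓ prefixSum b j ≡ prefixSum c j ⊓ prefixSum d j) →
  head c ≡ head b → tail c ≗ tail a → c ≗ a ⊎ c ≗ b
first-swapped-rest-same {a = a} {b} {c} {d} sums prefixes c₀≡b₀ c′≗a′ with head a ≟ head b
... | yes a₀≡b₀ = inj₁ (≗-from-head-tail (trans c₀≡b₀ (sym a₀≡b₀)) c′≗a′)
... | no a₀≢b₀  = inj₂ (≗-from-head-tail c₀≡b₀ (λ t → trans (c′≗a′ t) (a′≗b′ t)))
  where
  open ≡-Reasoning
  d₀≡a₀ : head d ≡ head a
  d₀≡a₀ = partner-swap (sums fzero) c₀≡b₀
  d′≗b′ : tail d ≗ tail b
  d′≗b′ t = partner-same (sums (fsuc t)) (c′≗a′ t)
  a′≗b′ : tail a ≗ tail b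
  a′≗b′ = prefixSum-injective (λ j → ⊓-cross-cancel a₀≢b₀ (begin
    (head a + prefixSum (tail a) j) ⊓ (head b + prefixSum (tail b) j)
      ≡⟨ prefixes (fsuc j) ⟩
    (head c + prefixSum (tail c) j) ⊓ (head d + prefixSum (tail d) j)
      ≡⟨ cong₂ _⊓_ (cong₂ _+_ c₀≡b₀ (prefixSum-cong c′≗a′ j))
                   (cong₂ _+_ d₀≡a₀ (prefixSum-cong d′≗b′ j)) ⟩
    (head b + prefixSum (tail a) j) ⊓ (head a + prefixSum (tail b) j) ∎))

intervalMinima-determine-pair : ∀ {n} {a b c d : Weight n} → a ⊕ b ≗ c ⊕ d →
  (∀ i j → toℕ i ≤ toℕ j →
     intervalSum i j a ⊓ intervalSum i j b ≡ intervalSum i j c ⊓ intervalSum i j d) →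
  c ≗ a ⊎ c ≗ b
intervalMinima-determine-pair {zero} _ _ = inj₁ (λ ())
intervalMinima-determine-pair {suc n} {a} {b} {c} {d} sums minima =
  combine (intervalMinima-determine-pair (sums ∘ fsuc) tail-minima) (⊓-+-member (prefixes fzero) (sums fzero))
  where
  prefixes : ∀ j → prefixSum a j ⊓ prefixSum b j ≡ prefixSum c j ⊓ prefixSum d j
  prefixes j = begin
    prefixSum a j ⊓ prefixSum b j
      ≡⟨ sym (cong₂ _⊓_ (intervalSum-zero j a) (intervalSum-zero j b)) ⟩
    intervalSum fzero j a ⊓ intervalSum fzero j b
      ≡⟨ minima fzero j z≤n ⟩
    intervalSum fzero j c ⊓ intervalSum fzero j d
      ≡⟨ cong₂ _⊓_ (intervalSum-zero j c) (intervalSum-zero j d) ⟩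
    prefixSum c j ⊓ prefixSum d j ∎
    where open ≡-Reasoning
  tail-minima : ∀ i j → toℕ i ≤ toℕ j →
    intervalSum i j (tail a) ⊓ intervalSum i j (tail b) ≡ intervalSum i j (tail c) ⊓ intervalSum i j (tail d)
  tail-minima i j i≤j = begin
    intervalSum i j (tail a) ⊓ intervalSum i j (tail b)
      ≡⟨ sym (cong₂ _⊓_ (intervalSum-suc i j a) (intervalSum-suc i j b)) ⟩
    intervalSum (fsuc i) (fsuc j) a ⊓ intervalSum (fsuc i) (fsuc j) b
      ≡⟨ minima (fsuc i) (fsuc j) (s≤s i≤j) ⟩
    intervalSum (fsuc i) (fsuc j) c ⊓ intervalSum (fsuc i) (fsuc j) d
      ≡⟨ cong₂ _⊓_ (intervalSum-suc i j c) (intervalSum-suc i j d) ⟩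
    intervalSum i j (tail c) ⊓ intervalSum i j (tail d) ∎
    where open ≡-Reasoning
  combine : tail c ≗ tail a ⊎ tail c ≗ tail b → head c ≡ head a ⊎ head c ≡ head b → c ≗ a ⊎ c ≗ b
  combine (inj₁ c′≗a′) (inj₁ c₀≡a₀) = inj₁ (≗-from-head-tail c₀≡a₀ c′≗a′)
  combine (inj₂ c′≗b′) (inj₂ c₀≡b₀) = inj₂ (≗-from-head-tail c₀≡b₀ c′≗b′)
  combine (inj₁ c′≗a′) (inj₂ c₀≡b₀) = first-swapped-rest-same sums prefixes c₀≡b₀ c′≗a′
  combine (inj₂ c′≗b′) (inj₁ c₀≡a₀) =
    swap (complement-side sums′ (first-swapped-rest-same sums′ prefixes′ d₀≡b₀ d′≗a′))
    where
    sums′ : a ⊕ b ≗ d ⊕ c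
    sums′ t = trans (sums t) (+-comm (c t) (d t))
    prefixes′ : ∀ j → prefixSum a j ⊓ prefixSum b j ≡ prefixSum d j ⊓ prefixSum c j
    prefixes′ j = trans (prefixes j) (⊓-comm (prefixSum c j) (prefixSum d j))
    d₀≡b₀ : head d ≡ head b
    d₀≡b₀ = partner-same (sums fzero) c₀≡a₀
    d′≗a′ : tail d ≗ tail a
    d′≗a′ t = partner-swap (sums (fsuc t)) (c′≗b′ t)

part₁ part₂ : ∀ {n} {m : Weight n} → P2 m → Weight n
part₁ = proj₁ ∘ proj₁
part₂ = proj₂ ∘ proj₁

parts-sum : ∀ {n} {m : Weight n} (p q : P2 m) → part₁ p ⊕ part₂ p ≗ part₁ q ⊕ part₂ q
parts-sum p q t = trans (proj₂ p t) (sym (proj₂ q t))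

r2-constant : ∀ {n} {m : Weight n} (i j : Fin n) (p q : P2 m) → r2 i j p ≡ r2 i j q
r2-constant i j p q = intervalSum-cong i j (parts-sum p q)

∼-same : ∀ {n} {m : Weight n} (p q : P2 m) → part₁ q ≗ part₁ p → p ∼ q
∼-same p q q₁≗p₁ i j _ =
  cong₂ _⊓_ (intervalSum-cong i j (sym ∘ q₁≗p₁))
            (intervalSum-cong i j (λ t → sym (partner-same (parts-sum p q t) (q₁≗p₁ t)))) ,
  r2-constant i j p q

∼-swapped : ∀ {n} {m : Weight n} (p q : P2 m) → part₁ q ≗ part₂ p → p ∼ q
∼-swapped p q q₁≗p₂ i j _ =
  trans (cong₂ _⊓_ (intervalSum-cong i j (λ t → sym (partner-swap (parts-sum p q t) (q₁≗p₂ t))))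
                   (intervalSum-cong i j (sym ∘ q₁≗p₂)))
        (⊓-comm _ _) ,
  r2-constant i j p q

∼⇒same⊎swapped : ∀ {n} {m : Weight n} (p q : P2 m) → p ∼ q → part₁ q ≗ part₁ p ⊎ part₁ q ≗ part₂ p
∼⇒same⊎swapped p q p∼q =
  intervalMinima-determine-pair (parts-sum p q) (λ i j i≤j → proj₁ (p∼q i j i≤j))

fromDigits : ∀ {n} → Weight n → Weight n → ℕ
fromDigits {zero}  m a = 0
fromDigits {suc n} m a = head a + fromDigits (tail m) (tail a) * suc (head m)

digits : ∀ {n} → Weight n → ℕ → Weight n
digits m c fzero    = c % suc (head m)
digits m c (fsuc t) = digits (tail m) (c / suc (head m)) t

digits-≤ : ∀ {n} (m : Weight n) c t → digits m c t ≤ m t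
digits-≤ m c fzero    = s≤s⁻¹ (m%n<n c (suc (head m)))
digits-≤ m c (fsuc t) = digits-≤ (tail m) (c / suc (head m)) t

fromDigits-cong : ∀ {n} (m : Weight n) {a b : Weight n} → a ≗ b → fromDigits m a ≡ fromDigits m b
fromDigits-cong {zero}  m a≗b = refl
fromDigits-cong {suc n} m a≗b =
  cong₂ _+_ (a≗b fzero) (cong (_* suc (head m)) (fromDigits-cong (tail m) (a≗b ∘ fsuc)))

fromDigits-digits : ∀ {n} (m : Weight n) {c} → c < prodSucc m → fromDigits m (digits m c) ≡ c
fromDigits-digits {zero}  m {zero} _ = refl
fromDigits-digits {zero}  m {suc c} (s≤s ())
fromDigits-digits {suc n} m {c} c<N = begin
  c % S + fromDigits (tail m) (digits (tail m) (c / S)) * S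
    ≡⟨ cong (λ x → c % S + x * S) (fromDigits-digits (tail m) (m<n*o⇒m/o<n (subst (c <_) (*-comm S _) c<N))) ⟩
  c % S + (c / S) * S
    ≡⟨ sym (m≡m%n+[m/n]*n c S) ⟩
  c ∎
  where
  open ≡-Reasoning
  S = suc (head m)

digits-fromDigits : ∀ {n} (m a : Weight n) → (∀ t → a t ≤ m t) → digits m (fromDigits m a) ≗ a
digits-fromDigits {suc n} m a a≤m fzero =
  trans ([m+kn]%n≡m%n (head a) (fromDigits (tail m) (tail a)) (suc (head m))) (m<n⇒m%n≡m (s≤s (a≤m fzero)))
digits-fromDigits {suc n} m a a≤m (fsuc t) =
  trans (cong (λ c → digits (tail m) c t) quotient) (digits-fromDigits (tail m) (tail a) (a≤m ∘ fsuc) t)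
  where
  S = suc (head m)
  C = fromDigits (tail m) (tail a)
  a₀<S : head a < S
  a₀<S = s≤s (a≤m fzero)
  no-carry : head a % S + C * S % S < S
  no-carry = begin-strict
    head a % S + C * S % S  ≡⟨ cong₂ _+_ (m<n⇒m%n≡m a₀<S) (m*n%n≡0 C S) ⟩
    head a + 0              ≡⟨ +-identityʳ (head a) ⟩
    head a                  <⟨ a₀<S ⟩
    S                       ∎
    where open ≤-Reasoning
  quotient : (head a + C * S) / S ≡ C
  quotient = begin
    (head a + C * S) / S    ≡⟨ +-distrib-/ (head a) (C * S) no-carry ⟩
    head a / S + C * S / S  ≡⟨ cong₂ _+_ (m<n⇒m/n≡0 a₀<S) (m*n/n≡m C S) ⟩
    C                       ∎
    where open ≡-Reasoning

fromDigits-complement : ∀ {n} (m a b : Weight n) → a ⊕ b ≗ m → suc (fromDigits m a + fromDigits m b) ≡ prodSucc m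
fromDigits-complement {zero}  m a b a⊕b≗m = refl
fromDigits-complement {suc n} m a b a⊕b≗m = begin
  suc ((head a + A * suc (head m)) + (head b + B * suc (head m)))
    ≡⟨ cong (λ x → suc ((head a + A * suc x) + (head b + B * suc x))) (sym (a⊕b≗m fzero)) ⟩
  suc ((head a + A * suc (head a + head b)) + (head b + B * suc (head a + head b)))
    ≡⟨ factor (head a) (head b) A B ⟩
  suc (head a + head b) * suc (A + B)
    ≡⟨ cong₂ (λ x y → suc x * y) (a⊕b≗m fzero)
             (fromDigits-complement (tail m) (tail a) (tail b) (a⊕b≗m ∘ fsuc)) ⟩
  prodSucc m ∎
  where
  open ≡-Reasoning
  A = fromDigits (tail m) (tail a)
  B = fromDigits (tail m) (tail b)
  factor : ∀ x y A B → suc ((x + A * suc (x + y)) + (y + B * suc (x + y))) ≡ suc (x + y) * suc (A + B)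
  factor = solve-∀

2*n≡n+n : ∀ n → 2 * n ≡ n + n
2*n≡n+n n = cong (n +_) (+-identityʳ n)

complement-below-half : ∀ {c c′ N k} → suc (c + c′) ≡ N → N ≤ 2 * k → c < k ⊎ c′ < k
complement-below-half {c} {c′} {N} {k} N≡ N≤2k with c <? k | c′ <? k
... | yes c<k | _         = inj₁ c<k
... | no _    | yes c′<k  = inj₂ c′<k
... | no c≮k  | no c′≮k   = contradiction 2k<2k (n≮n (2 * k))
  where
  open ≤-Reasoning
  2k<2k : 2 * k < 2 * k
  2k<2k = begin-strict
    2 * k          ≡⟨ 2*n≡n+n k ⟩
    k + k          ≤⟨ +-mono-≤ (≮⇒≥ c≮k) (≮⇒≥ c′≮k) ⟩
    c + c′         <⟨ n<1+n (c + c′) ⟩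
    suc (c + c′)   ≡⟨ N≡ ⟩
    N              ≤⟨ N≤2k ⟩
    2 * k          ∎

complements-below-half-equal : ∀ {c c′ N k} → suc (c + c′) ≡ N → 2 * k ≤ suc N →
                               c < k → c′ < k → c ≡ c′
complements-below-half-equal {c} {c′} {N} {k} N≡ 2k≤1+N c<k c′<k =
  suc-injective (trans (tight N≡ c<k c′<k) (sym (tight (trans (cong suc (+-comm c′ c)) N≡) c′<k c<k)))
  where
  tight : ∀ {x y} → suc (x + y) ≡ N → x < k → y < k → suc x ≡ k
  tight {x} {y} N≡ x<k y<k = ≤-antisym x<k (+-cancelʳ-≤ k k (suc x) (begin
    k + k          ≡⟨ 2*n≡n+n k ⟨
    2 * k          ≤⟨ 2k≤1+N ⟩
    suc N          ≡⟨ cong suc N≡ ⟨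
    suc (suc (x + y)) ≡⟨ cong suc (+-suc x y) ⟨
    suc x + suc y  ≤⟨ +-monoʳ-≤ (suc x) y<k ⟩
    suc x + k      ∎))
    where open ≤-Reasoning

below-half⇒below : ∀ {a N k} → a < k → 2 * k ≤ suc N → a < N
below-half⇒below {a} {N} {k} a<k 2k≤1+N = s≤s⁻¹ (begin
  suc (suc a)  ≤⟨ +-mono-≤ (≤-trans (s≤s z≤n) a<k) a<k ⟩
  k + k        ≡⟨ 2*n≡n+n k ⟨
  2 * k        ≤⟨ 2k≤1+N ⟩
  suc N        ∎)
  where open ≤-Reasoning

digitsPair : ∀ {n} (m : Weight n) → ℕ → P2 m
digitsPair m c = (digits m c , λ t → m t ∸ digits m c t) , λ t → m+[n∸m]≡n (digits-≤ m c t)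

part₁-≤ : ∀ {n} {m : Weight n} (p : P2 m) t → part₁ p t ≤ m t
part₁-≤ p t = subst (part₁ p t ≤_) (proj₂ p t) (m≤m+n _ _)

part₂-≤ : ∀ {n} {m : Weight n} (p : P2 m) t → part₂ p t ≤ m t
part₂-≤ p t = subst (part₂ p t ≤_) (proj₂ p t) (m≤n+m _ _)

∼-digitsPair : ∀ {n} {m : Weight n} (p : P2 m) →
  p ∼ digitsPair m (fromDigits m (part₁ p)) × p ∼ digitsPair m (fromDigits m (part₂ p))
∼-digitsPair {m = m} p =
  ∼-same    p (digitsPair m (fromDigits m (part₁ p))) (digits-fromDigits m (part₁ p) (part₁-≤ p)) ,
  ∼-swapped p (digitsPair m (fromDigits m (part₂ p))) (digits-fromDigits m (part₂ p) (part₂-≤ p))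

numClasses-half : ∀ {n} (m : Weight n) k → prodSucc m ≤ 2 * k → 2 * k ≤ suc (prodSucc m) → NumClasses m k
numClasses-half m k N≤2k 2k≤1+N = representative , covers , separated
  where
  representative : Fin k → P2 m
  representative a = digitsPair m (toℕ a)
  code : Fin k → ℕ
  code a = fromDigits m (part₁ (representative a))
  code≡toℕ : ∀ a → code a ≡ toℕ a
  code≡toℕ a = fromDigits-digits m (below-half⇒below (toℕ<n a) 2k≤1+N)
  index : ∀ {c} → c < k → ∀ x → x ∼ digitsPair m c → Σ (Fin k) (λ a → x ∼ representative a)
  index c<k x x∼ = fromℕ< c<k , subst (λ c → x ∼ digitsPair m c) (sym (toℕ-fromℕ< c<k)) x∼
  covers : ∀ x → Σ (Fin k) (λ a → x ∼ representative a)
  covers x with complement-below-half (fromDigits-complement m (part₁ x) (part₂ x) (proj₂ x)) N≤2k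
  ... | inj₁ c<k = index c<k x (proj₁ (∼-digitsPair x))
  ... | inj₂ c<k = index c<k x (proj₂ (∼-digitsPair x))
  separated : ∀ a b → representative a ∼ representative b → a ≡ b
  separated a b ra∼rb with ∼⇒same⊎swapped (representative a) (representative b) ra∼rb
  ... | inj₁ same = toℕ-injective (trans (sym (code≡toℕ a)) (trans (sym (fromDigits-cong m same)) (code≡toℕ b)))
  ... | inj₂ swapped = toℕ-injective (complements-below-half-equal N≡ 2k≤1+N (toℕ<n a) (toℕ<n b))
    where
    N≡ : suc (toℕ a + toℕ b) ≡ prodSucc m
    N≡ = begin
      suc (toℕ a + toℕ b)
        ≡⟨ cong₂ (λ x y → suc (x + y)) (code≡toℕ a)
                 (trans (sym (fromDigits-cong m swapped)) (code≡toℕ b)) ⟨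
      suc (code a + fromDigits m (part₂ (representative a)))
        ≡⟨ fromDigits-complement m _ _ (proj₂ (representative a)) ⟩
      prodSucc m ∎
      where open ≡-Reasoning

2∣n⊎2∣1+n : ∀ n → 2 ∣ n ⊎ 2 ∣ suc n
2∣n⊎2∣1+n zero    = inj₁ (divides 0 refl)
2∣n⊎2∣1+n (suc n) with 2∣n⊎2∣1+n n
... | inj₁ 2∣n   = inj₂ (∣m∣n⇒∣m+n ∣-refl 2∣n)
... | inj₂ 2∣1+n = inj₁ 2∣1+n

allEven⊎prodSucc-even : ∀ {n} (m : Weight n) → AllEven m ⊎ 2 ∣ prodSucc m
allEven⊎prodSucc-even {zero}  m = inj₁ (λ ())
allEven⊎prodSucc-even {suc n} m with 2∣n⊎2∣1+n (head m) | allEven⊎prodSucc-even (tail m)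
... | inj₂ 2∣1+m₀ | _               = inj₂ (∣m⇒∣m*n (prodSucc (tail m)) 2∣1+m₀)
... | inj₁ _      | inj₂ 2∣N′       = inj₂ (∣n⇒∣m*n (suc (head m)) 2∣N′)
... | inj₁ 2∣m₀   | inj₁ tail-even  = inj₁ (λ { fzero → 2∣m₀ ; (fsuc t) → tail-even t })

allEven⇒prodSucc-odd : ∀ {n} (m : Weight n) → AllEven m → ∃ λ r → prodSucc m ≡ suc (2 * r)
allEven⇒prodSucc-odd {zero}  m allEven = 0 , refl
allEven⇒prodSucc-odd {suc n} m allEven with allEven fzero | allEven⇒prodSucc-odd (tail m) (allEven ∘ fsuc)
... | divides q m₀≡q*2 | r , N′≡ =
  r + q * suc (2 * r) , trans (cong₂ (λ x y → suc x * y) m₀≡q*2 N′≡) (odd*odd q r)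
  where
  odd*odd : ∀ q r → suc (q * 2) * suc (2 * r) ≡ suc (2 * (r + q * suc (2 * r)))
  odd*odd = solve-∀

proposition4p5 : ∀ (n : ℕ) (m : Weight n) →
    Σ ℕ (λ k → NumClasses m k ×
      ((AllEven m → 2 * k ≡ prodSucc m + 1) ×
       (¬ AllEven m → 2 * k ≡ prodSucc m)))
proposition4p5 n m with allEven⊎prodSucc-even m
... | inj₁ allEven =
  let (r , N≡) = allEven⇒prodSucc-odd m allEven
      2k≡1+N = trans (*-suc 2 r) (cong suc (sym N≡))
  in suc r ,
     numClasses-half m (suc r) (≤-trans (n≤1+n _) (≤-reflexive (sym 2k≡1+N))) (≤-reflexive 2k≡1+N) ,
     (λ _ → trans 2k≡1+N (+-comm 1 (prodSucc m))) ,
     (λ notAllEven → contradiction allEven notAllEven)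
... | inj₂ (divides q N≡q*2) =
  let 2k≡N = trans (*-comm 2 q) (sym N≡q*2)
  in q ,
     numClasses-half m q (≤-reflexive (sym 2k≡N)) (≤-trans (≤-reflexive 2k≡N) (n≤1+n _)) ,
     (λ allEven → let (r , N≡) = allEven⇒prodSucc-odd m allEven in contradiction (trans 2k≡N N≡) (even≢odd q r)) ,
     (λ _ → 2k≡N)
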